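{- For $s,t\in\mu_r$, $v\in\mathcal{A}_1$ and $w\in\mathcal{A}_r$: (i) $vx\diamond_s wz_t^{\delta}=(v\diamond_s wz_t^{\delta})z_t^{\delta}-(vy\diamond_s w)z_t^{\delta}$; (ii) $vy\diamond_s wz_t^{\delta}=(v\diamond_s wz_t^{\delta})(y\diamond_t1)+(vy\diamond_s w)z_t^{\delta}$.
   Context: Let $r\ge1$, $\mu_r$ the $r$-th roots of unity, $\mathcal{A}_r=\mathbb{Q}\langle x,y_s\mid s\in\mu_r\rangle$, $y=y_1$, $z=x+y_1$, $z_t=x+y_t$, $z_s^{\delta}=x+\delta(s)y_s$ with $\delta(1)=0$, $\delta(s)=1$ for $s\ne1$, $z_{k,s}=x^{k-1}y_s$, $\mathcal{A}_1=\mathbb{Q}\langle x,y\rangle\subset\mathcal{A}_r$. $\varphi$: automorphism of $\mathcal{A}_r$ with $\varphi(x)=z$, $\varphi(y_s)=\delta(s)y_s-y_1$. $\mathcal{I}(z_{k_1,s_1}\cdots z_{k_l,s_l}x^a)=z_{k_1,s_1}z_{k_2,s_1s_2}\cdots z_{k_l,s_1\cdots s_l}x^a$, $M_s(z_{k_1,s_1}\cdots z_{k_l,s_l}x^a)=z_{k_1,ss_1}z_{k_2,s_2}\cdots z_{k_l,s_l}x^a$ (linear, $a\ge0$), $\psi_s=\varphi\mathcal{I}M_s$. Diamond product $\diamond_s:\mathcal{A}_1\times\mathcal{A}_r\to\mathcal{A}_r$ ($s\in\mu_r$): $\mathbb{Q}$-bilinear, defined recursively for words $v\in\mathcal{A}_1,w\in\mathcal{A}_r$,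 $1\ne t\in\mu_r$ by $1\diamond_s w=w$, $v\diamond_s1=\psi_s\varphi(v)$, $vx\diamond_s wx=(v\diamond_s wx)x-(vy\diamond_s w)x$, $vy\diamond_s wx=(v\diamond_s wx)y+(vy\diamond_s w)x$, $vx\diamond_s wy=(v\diamond_s wy)x+(vx\diamond_s w)y$, $vy\diamond_s wy=(v\diamond_s wy)y-(vx\diamond_s w)y$, $vx\diamond_s wy_t=(v\diamond_s wy_t)x+(v\diamond_s wz_t)y_t-(vy\diamond_s w)y_t$, $vy\diamond_s wy_t=(v\diamond_s wy_t)y-(v\diamond_s wz_t)y_t+(vy\diamond_s w)y_t$. -}

module Defs where

open import Data.Nat using (ℕ; zero; suc)
import Data.Nat as ℕ
open import Data.Nat.DivMod using (_mod_)
open import Data.Fin using (Fin; toℕ)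
import Data.Fin as Fin
open import Data.Fin.Properties using () renaming (_≟_ to _≟F_)
open import Data.Rational using (ℚ; 0ℚ; 1ℚ; -_)
import Data.Rational as ℚ
open import Data.Rational.Properties using () renaming (_≟_ to _≟ℚ_)
open import Data.List using (List; []; _∷_; _++_; concatMap; map)
open import Data.Product using (_×_; _,_)
open import Data.Bool using (Bool; true; false; if_then_else_)
open import Relation.Nullary using (yes; no)
open import Relation.Binary.PropositionalEquality using (_≡_)

-- Roots of unity.  μ_r (r = suc n) is cyclic of order r; we represent
-- ζ^k ∈ μ_r (ζ a fixed primitive r-th root of unity) by k ∈ Fin r.

μ : ℕ → Set
μ n = Fin (suc n)

one : ∀ {n} → μ n
one = Fin.zero

_·_ : ∀ {n} → μ n → μ n → μ n
_·_ {n} s t = (toℕ s ℕ.+ toℕ t) mod (suc n)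

δ : ∀ {n} → μ n → ℚ
δ Fin.zero    = 0ℚ
δ (Fin.suc _) = 1ℚ

-- Words, written as snoc-lists (the last letter is outermost), over an
-- alphabet L.

data Word (L : Set) : Set where
  ε   : Word L
  _▸_ : Word L → L → Word L

infixl 6 _▸_

_⊙_ : ∀ {L} → Word L → Word L → Word L
u ⊙ ε       = u
u ⊙ (w ▸ a) = (u ⊙ w) ▸ a

-- Alphabet of A_1 = Q<x,y>
data L₁ : Set where
  x₁ y₁ : L₁

-- Alphabet of A_r = Q<x, y_s | s ∈ μ_r>
data Lr (n : ℕ) : Set where
  x : Lr n
  y : μ n → Lr n

-- Noncommutative polynomials: formal Q-linear combinations of words.
-- Equality of polynomials is equality of all coefficients (_≈_ below).

Poly : Set → Set
Poly L = List (ℚ × Word L)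

𝟘 : ∀ {L} → Poly L
𝟘 = []

𝟙 : ∀ {L} → Poly L
𝟙 = (1ℚ , ε) ∷ []

word : ∀ {L} → Word L → Poly L
word w = (1ℚ , w) ∷ []

lett : ∀ {L} → L → Poly L
lett a = word (ε ▸ a)

_⊕_ : ∀ {L} → Poly L → Poly L → Poly L
p ⊕ q = p ++ q

_◃_ : ∀ {L} → ℚ → Poly L → Poly L
c ◃ p = map (λ { (d , w) → (c ℚ.* d , w) }) p

⊖_ : ∀ {L} → Poly L → Poly L
⊖ p = (- 1ℚ) ◃ p

_⊝_ : ∀ {L} → Poly L → Poly L → Poly L
p ⊝ q = p ⊕ (⊖ q)

_⊛_ : ∀ {L} → Poly L → Poly L → Poly L
p ⊛ q = concatMap (λ { (c , u) → map (λ { (d , w) → (c ℚ.* d , u ⊙ w) }) q }) p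

infixl 7 _⊛_
infixl 6 _⊕_ _⊝_
infixr 8 _◃_
infix 9 ⊖_

lin : ∀ {L M} → (Word L → Poly M) → Poly L → Poly M
lin f []            = []
lin f ((c , w) ∷ p) = c ◃ f w ⊕ lin f p

hom : ∀ {L M} → (L → Poly M) → Poly L → Poly M
hom {L} {M} f = lin g
  where
  g : Word L → Poly M
  g ε       = 𝟙
  g (w ▸ a) = g w ⊛ f a

eqLr : ∀ {n} → Lr n → Lr n → Bool
eqLr x     x     = true
eqLr x     (y _) = false
eqLr (y _) x     = false
eqLr (y s) (y t) with s ≟F t
... | yes _ = true
... | no  _ = false

eqWord : ∀ {L} → (L → L → Bool) → Word L → Word L → Bool
eqWord e ε       ε       = true
eqWord e ε       (_ ▸ _) = false
eqWord e (_ ▸ _) ε       = false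
eqWord e (u ▸ a) (w ▸ b) with e a b
... | true  = eqWord e u w
... | false = false

coeff : ∀ {n} → Poly (Lr n) → Word (Lr n) → ℚ
coeff []            w = 0ℚ
coeff ((c , u) ∷ p) w =
  (if eqWord eqLr u w then c else 0ℚ) ℚ.+ coeff p w

_≈_ : ∀ {n} → Poly (Lr n) → Poly (Lr n) → Set
p ≈ q = ∀ w → coeff p w ≡ coeff q w

infix 4 _≈_

X : ∀ {n} → Poly (Lr n)
X = lett x

Y : ∀ {n} → μ n → Poly (Lr n)
Y s = lett (y s)

zδ : ∀ {n} → μ n → Poly (Lr n)
zδ t = X ⊕ δ t ◃ Y t

ι : ∀ {n} → Poly L₁ → Poly (Lr n)
ι = hom λ { x₁ → X ; y₁ → Y one }

φ : ∀ {n} → Poly (Lr n) → Poly (Lr n)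
φ = hom λ { x → X ⊕ Y one ; (y s) → δ s ◃ Y s ⊝ Y one }

yprod : ∀ {n} → Word (Lr n) → μ n
yprod ε           = one
yprod (w ▸ x)     = yprod w
yprod (w ▸ y s)   = yprod w · s

hasY : ∀ {n} → Word (Lr n) → Bool
hasY ε         = false
hasY (w ▸ x)   = hasY w
hasY (w ▸ y _) = true

-- I(z_{k1,s1} ... z_{kl,sl} x^a) = z_{k1,s1} z_{k2,s1 s2} ... z_{kl,s1...sl} x^a
Iw : ∀ {n} → Word (Lr n) → Word (Lr n)
Iw ε         = ε
Iw (w ▸ x)   = Iw w ▸ x
Iw (w ▸ y t) = Iw w ▸ y (yprod w · t)

-- M_s(z_{k1,s1} z_{k2,s2} ... x^a) = z_{k1,s s1} z_{k2,s2} ... x^a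
Mw : ∀ {n} → μ n → Word (Lr n) → Word (Lr n)
Mw s ε         = ε
Mw s (w ▸ x)   = Mw s w ▸ x
Mw s (w ▸ y t) = if hasY w then Mw s w ▸ y t else w ▸ y (s · t)

I : ∀ {n} → Poly (Lr n) → Poly (Lr n)
I = lin (λ w → word (Iw w))

M : ∀ {n} → μ n → Poly (Lr n) → Poly (Lr n)
M s = lin (λ w → word (Mw s w))

ψ : ∀ {n} → μ n → Poly (Lr n) → Poly (Lr n)
ψ s p = φ (I (M s p))

-- The diamond product on words, by recursion on the last letters.
-- The fuel argument is the total length (always exact), only used to
-- make the recursion structural.

len : ∀ {L} → Word L → ℕ
len ε       = 0
len (w ▸ _) = suc (len w)

◇aux : ∀ {n} → μ n → ℕ → Word L₁ → Word (Lr n) → Poly (Lr n)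
◇aux s k       ε w       = word w
◇aux s k       v ε       = ψ s (φ (ι (word v)))
◇aux s zero    (v ▸ a) (w ▸ b) = 𝟘
◇aux s (suc k) (v ▸ x₁) (w ▸ x) =
  ◇aux s k v (w ▸ x) ⊛ X ⊝ ◇aux s k (v ▸ y₁) w ⊛ X
◇aux s (suc k) (v ▸ y₁) (w ▸ x) =
  ◇aux s k v (w ▸ x) ⊛ Y one ⊕ ◇aux s k (v ▸ y₁) w ⊛ X
◇aux s (suc k) (v ▸ x₁) (w ▸ y Fin.zero) =
  ◇aux s k v (w ▸ y one) ⊛ X ⊕ ◇aux s k (v ▸ x₁) w ⊛ Y one
◇aux s (suc k) (v ▸ y₁) (w ▸ y Fin.zero) =
  ◇aux s k v (w ▸ y one) ⊛ Y one ⊝ ◇aux s k (v ▸ x₁) w ⊛ Y one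
◇aux s (suc k) (v ▸ x₁) (w ▸ y t@(Fin.suc _)) =
  ◇aux s k v (w ▸ y t) ⊛ X
  ⊕ (◇aux s k v (w ▸ x) ⊕ ◇aux s k v (w ▸ y t)) ⊛ Y t
  ⊝ ◇aux s k (v ▸ y₁) w ⊛ Y t
◇aux s (suc k) (v ▸ y₁) (w ▸ y t@(Fin.suc _)) =
  ◇aux s k v (w ▸ y t) ⊛ Y one
  ⊝ (◇aux s k v (w ▸ x) ⊕ ◇aux s k v (w ▸ y t)) ⊛ Y t
  ⊕ ◇aux s k (v ▸ y₁) w ⊛ Y t

◇w : ∀ {n} → μ n → Word L₁ → Word (Lr n) → Poly (Lr n)
◇w s v w = ◇aux s (len v ℕ.+ len w) v w

◇ : ∀ {n} → μ n → Poly L₁ → Poly (Lr n) → Poly (Lr n)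
◇ s p q = lin (λ v → lin (λ w → ◇w s v w) q) p

x̂ ŷ : Poly L₁
x̂ = lett x₁
ŷ = lett y₁

-- Both sides of (i) and (ii) are linear in v and in w, and lin commutes with right
-- multiplication, so it suffices to take words v = u and w = u′. As
-- u′ z_t^δ = u′ x + δ(t) u′ y_t, the left-hand side of (i) is then
-- u x ⋄ u′ x + δ(t) (u x ⋄ u′ y_t), and both summands are given by the defining recursion
-- of ⋄. For t = 1 the second summand is killed by δ(1) = 0; for t ≠ 1 the two recursions
-- add up to (u ⋄ u′ z_t^δ) z_t^δ − (u y ⋄ u′) z_t^δ. Identity (ii) is the same computation
-- with y ⋄_t 1 = y_1 − δ(t) y_t in place of the first right factor z_t^δ. Everything is
-- checked coefficientwise: the coefficient of p q at a word w is the sum of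
-- d · coeff p (w v⁻¹) over the terms d v of q, so each case becomes a linear identity over ℚ.

module Submission where

open import Defs
open import Data.Nat using (ℕ; suc)
import Data.Nat as ℕ
import Data.Nat.Properties as ℕₚ
open import Data.Nat.DivMod using (_mod_; m<n⇒m%n≡m)
import Data.Fin as Fin
open import Data.Fin using (toℕ)
open import Data.Fin.Properties using (toℕ-injective; toℕ-fromℕ<; toℕ<n)
open import Data.Rational using (ℚ; 0ℚ; 1ℚ; _+_; _*_; _-_; -_)
open import Data.Rational.Properties
  using (+-*-commutativeRing; _≟_; +-identityˡ; +-identityʳ; +-assoc;
         *-identityˡ; *-identityʳ; *-assoc; *-zeroˡ; *-zeroʳ; *-comm; *-distribˡ-+)
open import Data.List using ([]; _∷_; _++_; map)
open import Data.List.Properties using (concatMap-++; map-++; ++-assoc; ++-identityʳ)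
open import Data.Maybe using (Maybe; just; nothing; maybe′)
open import Data.Bool using (Bool; true; false; if_then_else_)
open import Data.Product using (_×_; _,_)
open import Function using (_∘_)
open import Relation.Binary.Bundles using (Setoid)
import Relation.Binary.Reasoning.Setoid as SetoidReasoning
open import Relation.Binary.PropositionalEquality
open import Relation.Nullary.Decidable using (dec⇒maybe)
open import Tactic.RingSolver using (solve-∀)
open import Tactic.RingSolver.Core.AlmostCommutativeRing
  using (AlmostCommutativeRing; fromCommutativeRing)

ℚ-ring : AlmostCommutativeRing _ _
ℚ-ring = fromCommutativeRing +-*-commutativeRing (λ q → dec⇒maybe (0ℚ ≟ q))

if-*ˡ : ∀ (b : Bool) c d → (if b then c * d else 0ℚ) ≡ c * (if b then d else 0ℚ)
if-*ˡ true  c d = refl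
if-*ˡ false c d = sym (*-zeroʳ c)

if-*ʳ : ∀ (b : Bool) c d → (if b then c * d else 0ℚ) ≡ d * (if b then c else 0ℚ)
if-*ʳ true  c d = *-comm c d
if-*ʳ false c d = sym (*-zeroʳ d)

module _ {n : ℕ} where

  -- Defs' _≈_ unfolds to a Π-type from which Agda cannot recover the two polynomials;
  -- as a record, _≋_ lets them be inferred in congruence lemmas.
  record _≋_ (p q : Poly (Lr n)) : Set where
    constructor coeffwise
    field coeff-≡ : p ≈ q

  open _≋_ public

  infix 4 _≋_

  ≋-setoid : Setoid _ _
  ≋-setoid = record
    { Carrier       = Poly (Lr n)
    ; _≈_           = _≋_
    ; isEquivalence = record
      { refl  = coeffwise λ _ → refl
      ; sym   = λ p≋q → coeffwise λ w → sym (coeff-≡ p≋q w)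
      ; trans = λ p≋q q≋r → coeffwise λ w → trans (coeff-≡ p≋q w) (coeff-≡ q≋r w)
      }
    }

  open Setoid ≋-setoid public
    using () renaming (refl to ≋-refl; trans to ≋-trans)

  module ≋-Reasoning = SetoidReasoning ≋-setoid

  coeff-⊕ : ∀ (p q : Poly (Lr n)) w → coeff (p ⊕ q) w ≡ coeff p w + coeff q w
  coeff-⊕ []            q w = sym (+-identityˡ (coeff q w))
  coeff-⊕ ((c , u) ∷ p) q w =
    trans (cong (head +_) (coeff-⊕ p q w)) (sym (+-assoc head (coeff p w) (coeff q w)))
    where head = if eqWord eqLr u w then c else 0ℚ

  coeff-◃ : ∀ c (p : Poly (Lr n)) w → coeff (c ◃ p) w ≡ c * coeff p w
  coeff-◃ c []            w = sym (*-zeroʳ c)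
  coeff-◃ c ((d , u) ∷ p) w =
    trans (cong₂ _+_ (if-*ˡ (eqWord eqLr u w) c d) (coeff-◃ c p w))
          (sym (*-distribˡ-+ c _ (coeff p w)))

  coeff-⊝ : ∀ (p q : Poly (Lr n)) w → coeff (p ⊝ q) w ≡ coeff p w - coeff q w
  coeff-⊝ p q w =
    trans (coeff-⊕ p (⊖ q) w) (cong (coeff p w +_) (trans (coeff-◃ (- 1ℚ) q w) (neg-one (coeff q w))))
    where
    neg-one : ∀ a → - 1ℚ * a ≡ - a
    neg-one = solve-∀ ℚ-ring

  ⊕-cong : ∀ {p p′ q q′ : Poly (Lr n)} → p ≋ p′ → q ≋ q′ → p ⊕ q ≋ p′ ⊕ q′
  ⊕-cong {p} {p′} {q} {q′} p≋p′ q≋q′ = coeffwise λ w →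
    trans (coeff-⊕ p q w)
          (trans (cong₂ _+_ (coeff-≡ p≋p′ w) (coeff-≡ q≋q′ w)) (sym (coeff-⊕ p′ q′ w)))

  ◃-cong : ∀ c {p q : Poly (Lr n)} → p ≋ q → c ◃ p ≋ c ◃ q
  ◃-cong c {p} {q} p≋q = coeffwise λ w →
    trans (coeff-◃ c p w) (trans (cong (c *_) (coeff-≡ p≋q w)) (sym (coeff-◃ c q w)))

  ◃-identityˡ : ∀ (p : Poly (Lr n)) → 1ℚ ◃ p ≋ p
  ◃-identityˡ p = coeffwise λ w → trans (coeff-◃ 1ℚ p w) (*-identityˡ (coeff p w))

  ◃-assoc : ∀ c d (p : Poly (Lr n)) → (c * d) ◃ p ≋ c ◃ (d ◃ p)
  ◃-assoc c d p = coeffwise λ w → begin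
    coeff ((c * d) ◃ p) w  ≡⟨ coeff-◃ (c * d) p w ⟩
    c * d * coeff p w      ≡⟨ *-assoc c d (coeff p w) ⟩
    c * (d * coeff p w)    ≡⟨ cong (c *_) (coeff-◃ d p w) ⟨
    c * coeff (d ◃ p) w    ≡⟨ coeff-◃ c (d ◃ p) w ⟨
    coeff (c ◃ (d ◃ p)) w  ∎
    where open ≡-Reasoning

  ◃-swap : ∀ c d (p : Poly (Lr n)) → c ◃ (d ◃ p) ≋ d ◃ (c ◃ p)
  ◃-swap c d p = begin
    c ◃ (d ◃ p)  ≈⟨ ◃-assoc c d p ⟨
    (c * d) ◃ p  ≡⟨ cong (_◃ p) (*-comm c d) ⟩
    (d * c) ◃ p  ≈⟨ ◃-assoc d c p ⟩
    d ◃ (c ◃ p)  ∎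
    where open ≋-Reasoning

  ◃-distribˡ-⊕ : ∀ c (p q : Poly (Lr n)) → c ◃ (p ⊕ q) ≡ c ◃ p ⊕ c ◃ q
  ◃-distribˡ-⊕ c p q = map-++ _ p q

  ⊕-interchange : ∀ (p q r s : Poly (Lr n)) → (p ⊕ q) ⊕ (r ⊕ s) ≋ (p ⊕ r) ⊕ (q ⊕ s)
  ⊕-interchange p q r s = coeffwise λ w → begin
    coeff ((p ⊕ q) ⊕ (r ⊕ s)) w
      ≡⟨ trans (coeff-⊕ (p ⊕ q) (r ⊕ s) w) (cong₂ _+_ (coeff-⊕ p q w) (coeff-⊕ r s w)) ⟩
    (coeff p w + coeff q w) + (coeff r w + coeff s w)
      ≡⟨ interchange (coeff p w) (coeff q w) (coeff r w) (coeff s w) ⟩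
    (coeff p w + coeff r w) + (coeff q w + coeff s w)
      ≡⟨ trans (coeff-⊕ (p ⊕ r) (q ⊕ s) w) (cong₂ _+_ (coeff-⊕ p r w) (coeff-⊕ q s w)) ⟨
    coeff ((p ⊕ r) ⊕ (q ⊕ s)) w
      ∎
    where
    open ≡-Reasoning
    interchange : ∀ a b c d → (a + b) + (c + d) ≡ (a + c) + (b + d)
    interchange = solve-∀ ℚ-ring

  -- Coefficients of products

  stripSuffix : Word (Lr n) → Word (Lr n) → Maybe (Word (Lr n))
  stripSuffix ε       w       = just w
  stripSuffix (v ▸ a) ε       = nothing
  stripSuffix (v ▸ a) (w ▸ b) = if eqLr a b then stripSuffix v w else nothing

  stripSuffix-⊙ : ∀ u v w → maybe′ (eqWord eqLr u) false (stripSuffix v w) ≡ eqWord eqLr (u ⊙ v) w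
  stripSuffix-⊙ u ε       w       = refl
  stripSuffix-⊙ u (v ▸ a) ε       = refl
  stripSuffix-⊙ u (v ▸ a) (w ▸ b) with eqLr a b
  ... | true  = stripSuffix-⊙ u v w
  ... | false = refl

  convolve : Poly (Lr n) → (Word (Lr n) → ℚ) → Word (Lr n) → ℚ
  convolve []            f w = 0ℚ
  convolve ((d , v) ∷ q) f w = d * maybe′ f 0ℚ (stripSuffix v w) + convolve q f w

  module _ {f g : Word (Lr n) → ℚ} where

    convolve-cong : ∀ q → (∀ w → f w ≡ g w) → ∀ w → convolve q f w ≡ convolve q g w
    convolve-cong []            f≗g w = refl
    convolve-cong ((d , v) ∷ q) f≗g w =
      cong₂ (λ a b → d * a + b) (maybe-cong (stripSuffix v w)) (convolve-cong q f≗g w)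
      where
      maybe-cong : ∀ m → maybe′ f 0ℚ m ≡ maybe′ g 0ℚ m
      maybe-cong (just u) = f≗g u
      maybe-cong nothing  = refl

    convolve-+ : ∀ q w → convolve q (λ u → f u + g u) w ≡ convolve q f w + convolve q g w
    convolve-+ []            w = sym (+-identityʳ 0ℚ)
    convolve-+ ((d , v) ∷ q) w =
      trans (cong₂ (λ a b → d * a + b) (maybe-+ (stripSuffix v w)) (convolve-+ q w))
            (regroup d _ _ (convolve q f w) (convolve q g w))
      where
      regroup : ∀ c a b d e → c * (a + b) + (d + e) ≡ (c * a + d) + (c * b + e)
      regroup = solve-∀ ℚ-ring
      maybe-+ : ∀ m → maybe′ (λ u → f u + g u) 0ℚ m ≡ maybe′ f 0ℚ m + maybe′ g 0ℚ m
      maybe-+ (just u) = refl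
      maybe-+ nothing  = sym (+-identityʳ 0ℚ)

  convolve-* : ∀ q c (f : Word (Lr n) → ℚ) w → convolve q (λ u → c * f u) w ≡ c * convolve q f w
  convolve-* []            c f w = sym (*-zeroʳ c)
  convolve-* ((d , v) ∷ q) c f w =
    trans (cong₂ (λ a b → d * a + b) (maybe-* (stripSuffix v w)) (convolve-* q c f w))
          (regroup c d _ (convolve q f w))
    where
    regroup : ∀ c d a b → d * (c * a) + c * b ≡ c * (d * a + b)
    regroup = solve-∀ ℚ-ring
    maybe-* : ∀ m → maybe′ (λ u → c * f u) 0ℚ m ≡ c * maybe′ f 0ℚ m
    maybe-* (just u) = refl
    maybe-* nothing  = sym (*-zeroʳ c)

  convolve-0 : ∀ q w → convolve q (λ _ → 0ℚ) w ≡ 0ℚ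
  convolve-0 q w = trans (convolve-* q 0ℚ (λ _ → 0ℚ) w) (*-zeroˡ (convolve q (λ _ → 0ℚ) w))

  coeff-term-⊛ : ∀ c u (q : Poly (Lr n)) w →
    coeff (map (λ { (d , v) → (c * d , u ⊙ v) }) q) w
      ≡ convolve q (λ u′ → if eqWord eqLr u u′ then c else 0ℚ) w
  coeff-term-⊛ c u []            w = refl
  coeff-term-⊛ c u ((d , v) ∷ q) w = cong₂ _+_ term (coeff-term-⊛ c u q w)
    where
    maybe-if : ∀ m → maybe′ (λ u′ → if eqWord eqLr u u′ then c else 0ℚ) 0ℚ m
                       ≡ (if maybe′ (eqWord eqLr u) false m then c else 0ℚ)
    maybe-if (just u′) = refl
    maybe-if nothing   = refl

    term : (if eqWord eqLr (u ⊙ v) w then c * d else 0ℚ)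
             ≡ d * maybe′ (λ u′ → if eqWord eqLr u u′ then c else 0ℚ) 0ℚ (stripSuffix v w)
    term = begin
      (if eqWord eqLr (u ⊙ v) w then c * d else 0ℚ)
        ≡⟨ if-*ʳ (eqWord eqLr (u ⊙ v) w) c d ⟩
      d * (if eqWord eqLr (u ⊙ v) w then c else 0ℚ)
        ≡⟨ cong (λ b → d * (if b then c else 0ℚ)) (stripSuffix-⊙ u v w) ⟨
      d * (if maybe′ (eqWord eqLr u) false (stripSuffix v w) then c else 0ℚ)
        ≡⟨ cong (d *_) (maybe-if (stripSuffix v w)) ⟨
      d * maybe′ (λ u′ → if eqWord eqLr u u′ then c else 0ℚ) 0ℚ (stripSuffix v w)
        ∎
      where open ≡-Reasoning

  coeff-⊛ : ∀ (p q : Poly (Lr n)) w → coeff (p ⊛ q) w ≡ convolve q (coeff p) w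
  coeff-⊛ []            q w = sym (convolve-0 q w)
  coeff-⊛ ((c , u) ∷ p) q w = begin
    coeff (map (λ { (d , v) → (c * d , u ⊙ v) }) q ++ p ⊛ q) w
      ≡⟨ coeff-⊕ (map (λ { (d , v) → (c * d , u ⊙ v) }) q) (p ⊛ q) w ⟩
    coeff (map (λ { (d , v) → (c * d , u ⊙ v) }) q) w + coeff (p ⊛ q) w
      ≡⟨ cong₂ _+_ (coeff-term-⊛ c u q w) (coeff-⊛ p q w) ⟩
    convolve q (λ u′ → if eqWord eqLr u u′ then c else 0ℚ) w + convolve q (coeff p) w
      ≡⟨ convolve-+ q w ⟨
    convolve q (coeff ((c , u) ∷ p)) w
      ∎
    where open ≡-Reasoning

  ⊛-congˡ : ∀ {p p′ : Poly (Lr n)} q → p ≋ p′ → p ⊛ q ≋ p′ ⊛ q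
  ⊛-congˡ {p} {p′} q p≋p′ = coeffwise λ w →
    trans (coeff-⊛ p q w) (trans (convolve-cong q (coeff-≡ p≋p′) w) (sym (coeff-⊛ p′ q w)))

  ⊛-distribʳ-⊕ : ∀ (p p′ q : Poly (Lr n)) → (p ⊕ p′) ⊛ q ≡ p ⊛ q ⊕ p′ ⊛ q
  ⊛-distribʳ-⊕ p p′ q = concatMap-++ _ p p′

  coeff-⊛-⊕ : ∀ (p q r : Poly (Lr n)) w → coeff ((p ⊕ q) ⊛ r) w ≡ coeff (p ⊛ r) w + coeff (q ⊛ r) w
  coeff-⊛-⊕ p q r w = trans (cong (λ e → coeff e w) (⊛-distribʳ-⊕ p q r)) (coeff-⊕ (p ⊛ r) (q ⊛ r) w)

  ◃-⊛ : ∀ c (p q : Poly (Lr n)) → (c ◃ p) ⊛ q ≋ c ◃ (p ⊛ q)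
  ◃-⊛ c p q = coeffwise λ w → begin
    coeff ((c ◃ p) ⊛ q) w                  ≡⟨ coeff-⊛ (c ◃ p) q w ⟩
    convolve q (coeff (c ◃ p)) w           ≡⟨ convolve-cong q (coeff-◃ c p) w ⟩
    convolve q (λ u → c * coeff p u) w     ≡⟨ convolve-* q c (coeff p) w ⟩
    c * convolve q (coeff p) w             ≡⟨ cong (c *_) (coeff-⊛ p q w) ⟨
    c * coeff (p ⊛ q) w                    ≡⟨ coeff-◃ c (p ⊛ q) w ⟨
    coeff (c ◃ (p ⊛ q)) w                  ∎
    where open ≡-Reasoning

  coeff-⊛-zδ : ∀ t (p : Poly (Lr n)) w →
    coeff (p ⊛ zδ t) w ≡ coeff (p ⊛ X) w + δ t * coeff (p ⊛ Y t) w
  coeff-⊛-zδ t p w = begin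
    coeff (p ⊛ zδ t) w  ≡⟨ coeff-⊛ p (zδ t) w ⟩
    convolve (zδ t) (coeff p) w  ≡⟨ regroup (δ t) (after x) (after (y t)) ⟩
    convolve X (coeff p) w + δ t * convolve (Y t) (coeff p) w
      ≡⟨ cong₂ (λ a b → a + δ t * b) (coeff-⊛ p X w) (coeff-⊛ p (Y t) w) ⟨
    coeff (p ⊛ X) w + δ t * coeff (p ⊛ Y t) w  ∎
    where
    open ≡-Reasoning
    after : Lr n → ℚ
    after a = maybe′ (coeff p) 0ℚ (stripSuffix (ε ▸ a) w)
    regroup : ∀ d a b → 1ℚ * a + ((d * 1ℚ) * b + 0ℚ) ≡ (1ℚ * a + 0ℚ) + d * (1ℚ * b + 0ℚ)
    regroup = solve-∀ ℚ-ring

  toℕ-mod : ∀ (t : μ n) → toℕ t mod suc n ≡ t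
  toℕ-mod t = toℕ-injective (trans (toℕ-fromℕ< _) (m<n⇒m%n≡m (toℕ<n t)))

  ·-identityˡ : ∀ (t : μ n) → one · t ≡ t
  ·-identityˡ = toℕ-mod

  ·-identityʳ : ∀ (t : μ n) → t · one ≡ t
  ·-identityʳ t = trans (cong (_mod suc n) (ℕₚ.+-identityʳ (toℕ t))) (toℕ-mod t)

  coeff-⊛-◇ŷ𝟙 : ∀ t (p : Poly (Lr n)) w →
    coeff (p ⊛ ◇ t ŷ 𝟙) w ≡ coeff (p ⊛ Y one) w - δ t * coeff (p ⊛ Y t) w
  coeff-⊛-◇ŷ𝟙 t p w = begin
    coeff (p ⊛ ◇ t ŷ 𝟙) w            ≡⟨ coeff-⊛ p (◇ t ŷ 𝟙) w ⟩
    convolve (◇ t ŷ 𝟙) (coeff p) w   ≡⟨ expand ⟩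
    convolve (Y one) (coeff p) w - δ t * convolve (Y t) (coeff p) w
      ≡⟨ cong₂ (λ a b → a - δ t * b) (coeff-⊛ p (Y one) w) (coeff-⊛ p (Y t) w) ⟨
    coeff (p ⊛ Y one) w - δ t * coeff (p ⊛ Y t) w  ∎
    where
    open ≡-Reasoning
    after : Lr n → ℚ
    after a = maybe′ (coeff p) 0ℚ (stripSuffix (ε ▸ a) w)
    -- ◇ t ŷ 𝟙 evaluates ψ_t(φ(y)) literally, to four terms with these scalars and with the
    -- index of y_t computed as one · (t · one).
    regroup : ∀ d a b →
      (1ℚ * (1ℚ * (0ℚ * (1ℚ * (d * 1ℚ))))) * b
        + (0ℚ * a + ((1ℚ * (1ℚ * (- 1ℚ * (1ℚ * (d * 1ℚ))))) * b + (1ℚ * a + 0ℚ)))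
      ≡ (1ℚ * a + 0ℚ) - d * (1ℚ * b + 0ℚ)
    regroup = solve-∀ ℚ-ring
    expand : convolve (◇ t ŷ 𝟙) (coeff p) w
             ≡ convolve (Y one) (coeff p) w - δ t * convolve (Y t) (coeff p) w
    expand rewrite ·-identityˡ (t · one) | ·-identityʳ t = regroup (δ t) (after (y one)) (after (y t))

  -- Linear extensions

  module _ {L : Set} where

    lin-++ : ∀ (f : Word L → Poly (Lr n)) p q → lin f (p ++ q) ≡ lin f p ⊕ lin f q
    lin-++ f []            q = refl
    lin-++ f ((c , u) ∷ p) q =
      trans (cong (c ◃ f u ⊕_) (lin-++ f p q)) (sym (++-assoc (c ◃ f u) (lin f p) (lin f q)))

    lin-cong : ∀ {f g : Word L → Poly (Lr n)} → (∀ u → f u ≋ g u) → ∀ p → lin f p ≋ lin g p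
    lin-cong f≋g []            = ≋-refl
    lin-cong f≋g ((c , u) ∷ p) = ⊕-cong (◃-cong c (f≋g u)) (lin-cong f≋g p)

    lin-⊕ : ∀ (f g : Word L → Poly (Lr n)) p → lin (λ u → f u ⊕ g u) p ≋ lin f p ⊕ lin g p
    lin-⊕ f g []            = ≋-refl
    lin-⊕ f g ((c , u) ∷ p) = begin
      c ◃ (f u ⊕ g u) ⊕ lin (λ u → f u ⊕ g u) p  ≡⟨ cong (_⊕ _) (◃-distribˡ-⊕ c (f u) (g u)) ⟩
      (c ◃ f u ⊕ c ◃ g u) ⊕ lin (λ u → f u ⊕ g u) p  ≈⟨ ⊕-cong ≋-refl (lin-⊕ f g p) ⟩
      (c ◃ f u ⊕ c ◃ g u) ⊕ (lin f p ⊕ lin g p)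
        ≈⟨ ⊕-interchange (c ◃ f u) (c ◃ g u) (lin f p) (lin g p) ⟩
      (c ◃ f u ⊕ lin f p) ⊕ (c ◃ g u ⊕ lin g p)  ∎
      where open ≋-Reasoning

    lin-◃ : ∀ c (f : Word L → Poly (Lr n)) p → lin (λ u → c ◃ f u) p ≋ c ◃ lin f p
    lin-◃ c f []            = ≋-refl
    lin-◃ c f ((d , u) ∷ p) = begin
      d ◃ (c ◃ f u) ⊕ lin (λ u → c ◃ f u) p  ≈⟨ ⊕-cong (◃-swap d c (f u)) (lin-◃ c f p) ⟩
      c ◃ (d ◃ f u) ⊕ c ◃ lin f p            ≡⟨ ◃-distribˡ-⊕ c (d ◃ f u) (lin f p) ⟨
      c ◃ (d ◃ f u ⊕ lin f p)                ∎
      where open ≋-Reasoning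

    ⊛-lin : ∀ (f : Word L → Poly (Lr n)) p q → lin f p ⊛ q ≋ lin (λ u → f u ⊛ q) p
    ⊛-lin f []            q = ≋-refl
    ⊛-lin f ((c , u) ∷ p) q = begin
      (c ◃ f u ⊕ lin f p) ⊛ q        ≡⟨ ⊛-distribʳ-⊕ (c ◃ f u) (lin f p) q ⟩
      (c ◃ f u) ⊛ q ⊕ lin f p ⊛ q    ≈⟨ ⊕-cong (◃-⊛ c (f u) q) (⊛-lin f p q) ⟩
      c ◃ (f u ⊛ q) ⊕ lin (λ u → f u ⊛ q) p  ∎
      where open ≋-Reasoning

    lin-term-⊛ : ∀ (f : Word L → Poly (Lr n)) c u q →
      lin f (map (λ { (d , v) → (c * d , u ⊙ v) }) q) ≋ c ◃ lin (f ∘ (u ⊙_)) q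
    lin-term-⊛ f c u []            = ≋-refl
    lin-term-⊛ f c u ((d , v) ∷ q) = begin
      (c * d) ◃ f (u ⊙ v) ⊕ lin f (map (λ { (d , v) → (c * d , u ⊙ v) }) q)
        ≈⟨ ⊕-cong (◃-assoc c d (f (u ⊙ v))) (lin-term-⊛ f c u q) ⟩
      c ◃ (d ◃ f (u ⊙ v)) ⊕ c ◃ lin (f ∘ (u ⊙_)) q
        ≡⟨ ◃-distribˡ-⊕ c (d ◃ f (u ⊙ v)) (lin (f ∘ (u ⊙_)) q) ⟨
      c ◃ (d ◃ f (u ⊙ v) ⊕ lin (f ∘ (u ⊙_)) q)
        ∎
      where open ≋-Reasoning

    lin-⊛ : ∀ (f : Word L → Poly (Lr n)) p q → lin f (p ⊛ q) ≋ lin (λ u → lin (f ∘ (u ⊙_)) q) p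
    lin-⊛ f []            q = ≋-refl
    lin-⊛ f ((c , u) ∷ p) q = begin
      lin f (map (λ { (d , v) → (c * d , u ⊙ v) }) q ++ p ⊛ q)
        ≡⟨ lin-++ f (map (λ { (d , v) → (c * d , u ⊙ v) }) q) (p ⊛ q) ⟩
      lin f (map (λ { (d , v) → (c * d , u ⊙ v) }) q) ⊕ lin f (p ⊛ q)
        ≈⟨ ⊕-cong (lin-term-⊛ f c u q) (lin-⊛ f p q) ⟩
      c ◃ lin (f ∘ (u ⊙_)) q ⊕ lin (λ u → lin (f ∘ (u ⊙_)) q) p
        ∎
      where open ≋-Reasoning

    lin-combination : ∀ (f g : Word L → Poly (Lr n)) q c r p →
      lin (λ u → f u ⊛ q ⊕ c ◃ (g u ⊛ r)) p ≋ lin f p ⊛ q ⊕ c ◃ (lin g p ⊛ r)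
    lin-combination f g q c r p = begin
      lin (λ u → f u ⊛ q ⊕ c ◃ (g u ⊛ r)) p
        ≈⟨ lin-⊕ (λ u → f u ⊛ q) (λ u → c ◃ (g u ⊛ r)) p ⟩
      lin (λ u → f u ⊛ q) p ⊕ lin (λ u → c ◃ (g u ⊛ r)) p
        ≈⟨ ⊕-cong (⊛-lin f p q) ≋-refl ⟨
      lin f p ⊛ q ⊕ lin (λ u → c ◃ (g u ⊛ r)) p
        ≈⟨ ⊕-cong ≋-refl (lin-◃ c (λ u → g u ⊛ r) p) ⟩
      lin f p ⊛ q ⊕ c ◃ lin (λ u → g u ⊛ r) p
        ≈⟨ ⊕-cong ≋-refl (◃-cong c (⊛-lin g p r)) ⟨
      lin f p ⊛ q ⊕ c ◃ (lin g p ⊛ r)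
        ∎
      where open ≋-Reasoning

    lin-lett : ∀ (f : Word L → Poly (Lr n)) a → lin f (lett a) ≋ f (ε ▸ a)
    lin-lett f a = begin
      1ℚ ◃ f (ε ▸ a) ⊕ []  ≡⟨ ++-identityʳ (1ℚ ◃ f (ε ▸ a)) ⟩
      1ℚ ◃ f (ε ▸ a)       ≈⟨ ◃-identityˡ (f (ε ▸ a)) ⟩
      f (ε ▸ a)            ∎
      where open ≋-Reasoning

    lin-⊛-lett : ∀ (f : Word L → Poly (Lr n)) a p → lin f (p ⊛ lett a) ≋ lin (λ u → f (u ▸ a)) p
    lin-⊛-lett f a p = begin
      lin f (p ⊛ lett a)                            ≈⟨ lin-⊛ f p (lett a) ⟩
      lin (λ u → lin (f ∘ (u ⊙_)) (lett a)) p       ≈⟨ lin-cong (λ u → lin-lett (f ∘ (u ⊙_)) a) p ⟩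
      lin (λ u → f (u ▸ a)) p                       ∎
      where open ≋-Reasoning

  at-zδ : μ n → (Word (Lr n) → Poly (Lr n)) → Word (Lr n) → Poly (Lr n)
  at-zδ t f u = f (u ▸ x) ⊕ δ t ◃ f (u ▸ y t)

  lin-zδ : ∀ t (f : Word (Lr n) → Poly (Lr n)) → lin f (zδ t) ≋ at-zδ t f ε
  lin-zδ t f = begin
    1ℚ ◃ f (ε ▸ x) ⊕ ((δ t * 1ℚ) ◃ f (ε ▸ y t) ⊕ [])
      ≡⟨ cong (1ℚ ◃ f (ε ▸ x) ⊕_) (++-identityʳ _) ⟩
    1ℚ ◃ f (ε ▸ x) ⊕ (δ t * 1ℚ) ◃ f (ε ▸ y t)
      ≡⟨ cong (λ c → 1ℚ ◃ f (ε ▸ x) ⊕ c ◃ f (ε ▸ y t)) (*-identityʳ (δ t)) ⟩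
    1ℚ ◃ f (ε ▸ x) ⊕ δ t ◃ f (ε ▸ y t)
      ≈⟨ ⊕-cong (◃-identityˡ (f (ε ▸ x))) ≋-refl ⟩
    f (ε ▸ x) ⊕ δ t ◃ f (ε ▸ y t)
      ∎
    where open ≋-Reasoning

  lin-⊛-zδ : ∀ t (f : Word (Lr n) → Poly (Lr n)) w → lin f (w ⊛ zδ t) ≋ lin (at-zδ t f) w
  lin-⊛-zδ t f w = begin
    lin f (w ⊛ zδ t)                           ≈⟨ lin-⊛ f w (zδ t) ⟩
    lin (λ u → lin (f ∘ (u ⊙_)) (zδ t)) w      ≈⟨ lin-cong (λ u → lin-zδ t (f ∘ (u ⊙_))) w ⟩
    lin (at-zδ t f) w                          ∎
    where open ≋-Reasoning

  coeff-at-zδ : ∀ t (f : Word (Lr n) → Poly (Lr n)) u w →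
    coeff (at-zδ t f u) w ≡ coeff (f (u ▸ x)) w + δ t * coeff (f (u ▸ y t)) w
  coeff-at-zδ t f u w =
    trans (coeff-⊕ (f (u ▸ x)) (δ t ◃ f (u ▸ y t)) w)
          (cong (coeff (f (u ▸ x)) w +_) (coeff-◃ (δ t) (f (u ▸ y t)) w))

  coeff-at-zδ-⊛ : ∀ t (f : Word (Lr n) → Poly (Lr n)) u q w →
    coeff (at-zδ t f u ⊛ q) w ≡ coeff (f (u ▸ x) ⊛ q) w + δ t * coeff (f (u ▸ y t) ⊛ q) w
  coeff-at-zδ-⊛ t f u q w =
    trans (coeff-⊛-⊕ (f (u ▸ x)) (δ t ◃ f (u ▸ y t)) q w)
          (cong (coeff (f (u ▸ x) ⊛ q) w +_)
                (trans (coeff-≡ (◃-⊛ (δ t) (f (u ▸ y t)) q) w) (coeff-◃ (δ t) (f (u ▸ y t) ⊛ q) w)))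

  -- The diamond product

  -- ◇w passes fuel len u + suc (len u′) to its recursive call on (u ▸ y₁, u′), which is the
  -- exact length of that pair only propositionally.
  ◇aux-fuel : ∀ (s : μ n) u u′ → ◇aux s (len u ℕ.+ suc (len u′)) (u ▸ y₁) u′ ≡ ◇w s (u ▸ y₁) u′
  ◇aux-fuel s u u′ = cong (λ k → ◇aux s k (u ▸ y₁) u′) (ℕₚ.+-suc (len u) (len u′))

  module _ (s : μ n) (u : Word L₁) (u′ : Word (Lr n)) where

    private
      B : Poly (Lr n)
      B = ◇w s u (u′ ▸ x)

      A : μ n → Poly (Lr n)
      A t = ◇w s u (u′ ▸ y t)

      D : Poly (Lr n)
      D = ◇w s (u ▸ y₁) u′

    ◇w-x₁-x : ◇w s (u ▸ x₁) (u′ ▸ x) ≡ B ⊛ X ⊝ D ⊛ X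
    ◇w-x₁-x = cong (λ r → B ⊛ X ⊝ r ⊛ X) (◇aux-fuel s u u′)

    ◇w-y₁-x : ◇w s (u ▸ y₁) (u′ ▸ x) ≡ B ⊛ Y one ⊕ D ⊛ X
    ◇w-y₁-x = cong (λ r → B ⊛ Y one ⊕ r ⊛ X) (◇aux-fuel s u u′)

    ◇w-x₁-y : ∀ j → let t = Fin.suc j in
      ◇w s (u ▸ x₁) (u′ ▸ y t) ≡ A t ⊛ X ⊕ (B ⊕ A t) ⊛ Y t ⊝ D ⊛ Y t
    ◇w-x₁-y j = cong (λ r → A t ⊛ X ⊕ (B ⊕ A t) ⊛ Y t ⊝ r ⊛ Y t) (◇aux-fuel s u u′)
      where t = Fin.suc j

    ◇w-y₁-y : ∀ j → let t = Fin.suc j in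
      ◇w s (u ▸ y₁) (u′ ▸ y t) ≡ A t ⊛ Y one ⊝ (B ⊕ A t) ⊛ Y t ⊕ D ⊛ Y t
    ◇w-y₁-y j = cong (λ r → A t ⊛ Y one ⊝ (B ⊕ A t) ⊛ Y t ⊕ r ⊛ Y t) (◇aux-fuel s u u′)
      where t = Fin.suc j

    private
      normal-form-x : μ n → Word (Lr n) → ℚ
      normal-form-x t w =
        ((coeff (B ⊛ X) w + δ t * coeff (B ⊛ Y t) w) + δ t * (coeff (A t ⊛ X) w + δ t * coeff (A t ⊛ Y t) w))
        - (coeff (D ⊛ X) w + δ t * coeff (D ⊛ Y t) w)

      rhs-x : ∀ t w → coeff (at-zδ t (◇w s u) u′ ⊛ zδ t ⊝ D ⊛ zδ t) w ≡ normal-form-x t w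
      rhs-x t w = begin
        coeff (at-zδ t (◇w s u) u′ ⊛ zδ t ⊝ D ⊛ zδ t) w
          ≡⟨ coeff-⊝ (at-zδ t (◇w s u) u′ ⊛ zδ t) (D ⊛ zδ t) w ⟩
        coeff (at-zδ t (◇w s u) u′ ⊛ zδ t) w - coeff (D ⊛ zδ t) w
          ≡⟨ cong₂ _-_ (coeff-at-zδ-⊛ t (◇w s u) u′ (zδ t) w) (coeff-⊛-zδ t D w) ⟩
        (coeff (B ⊛ zδ t) w + δ t * coeff (A t ⊛ zδ t) w) - (coeff (D ⊛ X) w + δ t * coeff (D ⊛ Y t) w)
          ≡⟨ cong (_- (coeff (D ⊛ X) w + δ t * coeff (D ⊛ Y t) w))
                  (cong₂ (λ a b → a + δ t * b) (coeff-⊛-zδ t B w) (coeff-⊛-zδ t (A t) w)) ⟩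
        normal-form-x t w
          ∎
        where open ≡-Reasoning

      coeff-◇w-x₁-x : ∀ w → coeff (◇w s (u ▸ x₁) (u′ ▸ x)) w ≡ coeff (B ⊛ X) w - coeff (D ⊛ X) w
      coeff-◇w-x₁-x w = trans (cong (λ e → coeff e w) ◇w-x₁-x) (coeff-⊝ (B ⊛ X) (D ⊛ X) w)

      lhs-x : ∀ t w → coeff (at-zδ t (◇w s (u ▸ x₁)) u′) w ≡ normal-form-x t w
      lhs-x Fin.zero w = begin
        coeff (at-zδ Fin.zero (◇w s (u ▸ x₁)) u′) w
          ≡⟨ coeff-at-zδ Fin.zero (◇w s (u ▸ x₁)) u′ w ⟩
        coeff (◇w s (u ▸ x₁) (u′ ▸ x)) w + 0ℚ * junk
          ≡⟨ cong (_+ 0ℚ * junk) (coeff-◇w-x₁-x w) ⟩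
        (coeff (B ⊛ X) w - coeff (D ⊛ X) w) + 0ℚ * junk
          ≡⟨ regroup (coeff (B ⊛ X) w) (coeff (D ⊛ X) w) junk
                     (coeff (B ⊛ Y Fin.zero) w) (coeff (A Fin.zero ⊛ X) w)
                     (coeff (A Fin.zero ⊛ Y Fin.zero) w) (coeff (D ⊛ Y Fin.zero) w) ⟩
        normal-form-x Fin.zero w
          ∎
        where
        open ≡-Reasoning
        junk = coeff (◇w s (u ▸ x₁) (u′ ▸ y Fin.zero)) w
        regroup : ∀ bx dx j by ax ay dy →
          (bx - dx) + 0ℚ * j ≡ ((bx + 0ℚ * by) + 0ℚ * (ax + 0ℚ * ay)) - (dx + 0ℚ * dy)
        regroup = solve-∀ ℚ-ring
      lhs-x (Fin.suc j) w = begin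
        coeff (at-zδ t (◇w s (u ▸ x₁)) u′) w
          ≡⟨ coeff-at-zδ t (◇w s (u ▸ x₁)) u′ w ⟩
        coeff (◇w s (u ▸ x₁) (u′ ▸ x)) w + 1ℚ * coeff (◇w s (u ▸ x₁) (u′ ▸ y t)) w
          ≡⟨ cong₂ (λ a b → a + 1ℚ * b) (coeff-◇w-x₁-x w) y-part ⟩
        (coeff (B ⊛ X) w - coeff (D ⊛ X) w)
          + 1ℚ * ((coeff (A t ⊛ X) w + (coeff (B ⊛ Y t) w + coeff (A t ⊛ Y t) w)) - coeff (D ⊛ Y t) w)
          ≡⟨ regroup (coeff (B ⊛ X) w) (coeff (D ⊛ X) w) (coeff (A t ⊛ X) w)
                     (coeff (B ⊛ Y t) w) (coeff (A t ⊛ Y t) w) (coeff (D ⊛ Y t) w) ⟩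
        normal-form-x t w
          ∎
        where
        open ≡-Reasoning
        t = Fin.suc j
        y-part : coeff (◇w s (u ▸ x₁) (u′ ▸ y t)) w
                 ≡ (coeff (A t ⊛ X) w + (coeff (B ⊛ Y t) w + coeff (A t ⊛ Y t) w)) - coeff (D ⊛ Y t) w
        y-part = begin
          coeff (◇w s (u ▸ x₁) (u′ ▸ y t)) w
            ≡⟨ cong (λ e → coeff e w) (◇w-x₁-y j) ⟩
          coeff (A t ⊛ X ⊕ (B ⊕ A t) ⊛ Y t ⊝ D ⊛ Y t) w
            ≡⟨ coeff-⊝ (A t ⊛ X ⊕ (B ⊕ A t) ⊛ Y t) (D ⊛ Y t) w ⟩
          coeff (A t ⊛ X ⊕ (B ⊕ A t) ⊛ Y t) w - coeff (D ⊛ Y t) w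
            ≡⟨ cong (_- coeff (D ⊛ Y t) w)
                    (trans (coeff-⊕ (A t ⊛ X) ((B ⊕ A t) ⊛ Y t) w)
                           (cong (coeff (A t ⊛ X) w +_) (coeff-⊛-⊕ B (A t) (Y t) w))) ⟩
          (coeff (A t ⊛ X) w + (coeff (B ⊛ Y t) w + coeff (A t ⊛ Y t) w)) - coeff (D ⊛ Y t) w
            ∎
        regroup : ∀ bx dx ax by ay dy →
          (bx - dx) + 1ℚ * ((ax + (by + ay)) - dy)
            ≡ ((bx + 1ℚ * by) + 1ℚ * (ax + 1ℚ * ay)) - (dx + 1ℚ * dy)
        regroup = solve-∀ ℚ-ring

    at-zδ-◇w-x₁ : ∀ t →
      at-zδ t (◇w s (u ▸ x₁)) u′ ≋ at-zδ t (◇w s u) u′ ⊛ zδ t ⊝ ◇w s (u ▸ y₁) u′ ⊛ zδ t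
    at-zδ-◇w-x₁ t = coeffwise λ w → trans (lhs-x t w) (sym (rhs-x t w))

    private
      normal-form-y : μ n → Word (Lr n) → ℚ
      normal-form-y t w =
        ((coeff (B ⊛ Y one) w - δ t * coeff (B ⊛ Y t) w)
          + δ t * (coeff (A t ⊛ Y one) w - δ t * coeff (A t ⊛ Y t) w))
        + 1ℚ * (coeff (D ⊛ X) w + δ t * coeff (D ⊛ Y t) w)

      rhs-y : ∀ t w →
        coeff (at-zδ t (◇w s u) u′ ⊛ ◇ t ŷ 𝟙 ⊕ 1ℚ ◃ (D ⊛ zδ t)) w ≡ normal-form-y t w
      rhs-y t w = begin
        coeff (at-zδ t (◇w s u) u′ ⊛ ◇ t ŷ 𝟙 ⊕ 1ℚ ◃ (D ⊛ zδ t)) w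
          ≡⟨ coeff-⊕ (at-zδ t (◇w s u) u′ ⊛ ◇ t ŷ 𝟙) (1ℚ ◃ (D ⊛ zδ t)) w ⟩
        coeff (at-zδ t (◇w s u) u′ ⊛ ◇ t ŷ 𝟙) w + coeff (1ℚ ◃ (D ⊛ zδ t)) w
          ≡⟨ cong₂ _+_ (coeff-at-zδ-⊛ t (◇w s u) u′ (◇ t ŷ 𝟙) w)
                       (trans (coeff-◃ 1ℚ (D ⊛ zδ t) w) (cong (1ℚ *_) (coeff-⊛-zδ t D w))) ⟩
        (coeff (B ⊛ ◇ t ŷ 𝟙) w + δ t * coeff (A t ⊛ ◇ t ŷ 𝟙) w)
          + 1ℚ * (coeff (D ⊛ X) w + δ t * coeff (D ⊛ Y t) w)
          ≡⟨ cong (_+ 1ℚ * (coeff (D ⊛ X) w + δ t * coeff (D ⊛ Y t) w))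
                  (cong₂ (λ a b → a + δ t * b) (coeff-⊛-◇ŷ𝟙 t B w) (coeff-⊛-◇ŷ𝟙 t (A t) w)) ⟩
        normal-form-y t w
          ∎
        where open ≡-Reasoning

      coeff-◇w-y₁-x : ∀ w → coeff (◇w s (u ▸ y₁) (u′ ▸ x)) w ≡ coeff (B ⊛ Y one) w + coeff (D ⊛ X) w
      coeff-◇w-y₁-x w = trans (cong (λ e → coeff e w) ◇w-y₁-x) (coeff-⊕ (B ⊛ Y one) (D ⊛ X) w)

      lhs-y : ∀ t w → coeff (at-zδ t (◇w s (u ▸ y₁)) u′) w ≡ normal-form-y t w
      lhs-y Fin.zero w = begin
        coeff (at-zδ Fin.zero (◇w s (u ▸ y₁)) u′) w
          ≡⟨ coeff-at-zδ Fin.zero (◇w s (u ▸ y₁)) u′ w ⟩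
        coeff (◇w s (u ▸ y₁) (u′ ▸ x)) w + 0ℚ * junk
          ≡⟨ cong (_+ 0ℚ * junk) (coeff-◇w-y₁-x w) ⟩
        (coeff (B ⊛ Y one) w + coeff (D ⊛ X) w) + 0ℚ * junk
          ≡⟨ regroup (coeff (B ⊛ Y one) w) (coeff (D ⊛ X) w) junk
                     (coeff (B ⊛ Y Fin.zero) w) (coeff (A Fin.zero ⊛ Y one) w)
                     (coeff (A Fin.zero ⊛ Y Fin.zero) w) (coeff (D ⊛ Y Fin.zero) w) ⟩
        normal-form-y Fin.zero w
          ∎
        where
        open ≡-Reasoning
        junk = coeff (◇w s (u ▸ y₁) (u′ ▸ y Fin.zero)) w
        regroup : ∀ b1 dx j by a1 ay dy →
          (b1 + dx) + 0ℚ * j ≡ ((b1 - 0ℚ * by) + 0ℚ * (a1 - 0ℚ * ay)) + 1ℚ * (dx + 0ℚ * dy)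
        regroup = solve-∀ ℚ-ring
      lhs-y (Fin.suc j) w = begin
        coeff (at-zδ t (◇w s (u ▸ y₁)) u′) w
          ≡⟨ coeff-at-zδ t (◇w s (u ▸ y₁)) u′ w ⟩
        coeff (◇w s (u ▸ y₁) (u′ ▸ x)) w + 1ℚ * coeff (◇w s (u ▸ y₁) (u′ ▸ y t)) w
          ≡⟨ cong₂ (λ a b → a + 1ℚ * b) (coeff-◇w-y₁-x w) y-part ⟩
        (coeff (B ⊛ Y one) w + coeff (D ⊛ X) w)
          + 1ℚ * ((coeff (A t ⊛ Y one) w - (coeff (B ⊛ Y t) w + coeff (A t ⊛ Y t) w)) + coeff (D ⊛ Y t) w)
          ≡⟨ regroup (coeff (B ⊛ Y one) w) (coeff (D ⊛ X) w) (coeff (A t ⊛ Y one) w)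
                     (coeff (B ⊛ Y t) w) (coeff (A t ⊛ Y t) w) (coeff (D ⊛ Y t) w) ⟩
        normal-form-y t w
          ∎
        where
        open ≡-Reasoning
        t = Fin.suc j
        y-part : coeff (◇w s (u ▸ y₁) (u′ ▸ y t)) w
                 ≡ (coeff (A t ⊛ Y one) w - (coeff (B ⊛ Y t) w + coeff (A t ⊛ Y t) w)) + coeff (D ⊛ Y t) w
        y-part = begin
          coeff (◇w s (u ▸ y₁) (u′ ▸ y t)) w
            ≡⟨ cong (λ e → coeff e w) (◇w-y₁-y j) ⟩
          coeff (A t ⊛ Y one ⊝ (B ⊕ A t) ⊛ Y t ⊕ D ⊛ Y t) w
            ≡⟨ coeff-⊕ (A t ⊛ Y one ⊝ (B ⊕ A t) ⊛ Y t) (D ⊛ Y t) w ⟩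
          coeff (A t ⊛ Y one ⊝ (B ⊕ A t) ⊛ Y t) w + coeff (D ⊛ Y t) w
            ≡⟨ cong (_+ coeff (D ⊛ Y t) w)
                    (trans (coeff-⊝ (A t ⊛ Y one) ((B ⊕ A t) ⊛ Y t) w)
                           (cong (λ e → coeff (A t ⊛ Y one) w - e) (coeff-⊛-⊕ B (A t) (Y t) w))) ⟩
          (coeff (A t ⊛ Y one) w - (coeff (B ⊛ Y t) w + coeff (A t ⊛ Y t) w)) + coeff (D ⊛ Y t) w
            ∎
        regroup : ∀ b1 dx a1 by ay dy →
          (b1 + dx) + 1ℚ * ((a1 - (by + ay)) + dy)
            ≡ ((b1 - 1ℚ * by) + 1ℚ * (a1 - 1ℚ * ay)) + 1ℚ * (dx + 1ℚ * dy)
        regroup = solve-∀ ℚ-ring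

    at-zδ-◇w-y₁ : ∀ t →
      at-zδ t (◇w s (u ▸ y₁)) u′ ≋ at-zδ t (◇w s u) u′ ⊛ ◇ t ŷ 𝟙 ⊕ 1ℚ ◃ (◇w s (u ▸ y₁) u′ ⊛ zδ t)
    at-zδ-◇w-y₁ t = coeffwise λ w → trans (lhs-y t w) (sym (rhs-y t w))

  module _ (s t : μ n) (a : L₁) (q : Poly (Lr n)) (c : ℚ)
           (step : ∀ u u′ → at-zδ t (◇w s (u ▸ a)) u′
                             ≋ at-zδ t (◇w s u) u′ ⊛ q ⊕ c ◃ (◇w s (u ▸ y₁) u′ ⊛ zδ t)) where

    lin-◇w-▸-⊛zδ : ∀ u w → lin (◇w s (u ▸ a)) (w ⊛ zδ t)
                      ≋ lin (◇w s u) (w ⊛ zδ t) ⊛ q ⊕ c ◃ (lin (◇w s (u ▸ y₁)) w ⊛ zδ t)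
    lin-◇w-▸-⊛zδ u w = begin
      lin (◇w s (u ▸ a)) (w ⊛ zδ t)
        ≈⟨ lin-⊛-zδ t (◇w s (u ▸ a)) w ⟩
      lin (at-zδ t (◇w s (u ▸ a))) w
        ≈⟨ lin-cong (step u) w ⟩
      lin (λ u′ → at-zδ t (◇w s u) u′ ⊛ q ⊕ c ◃ (◇w s (u ▸ y₁) u′ ⊛ zδ t)) w
        ≈⟨ lin-combination (at-zδ t (◇w s u)) (◇w s (u ▸ y₁)) q c (zδ t) w ⟩
      lin (at-zδ t (◇w s u)) w ⊛ q ⊕ c ◃ (lin (◇w s (u ▸ y₁)) w ⊛ zδ t)
        ≈⟨ ⊕-cong (⊛-congˡ q (lin-⊛-zδ t (◇w s u) w)) ≋-refl ⟨
      lin (◇w s u) (w ⊛ zδ t) ⊛ q ⊕ c ◃ (lin (◇w s (u ▸ y₁)) w ⊛ zδ t)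
        ∎
      where open ≋-Reasoning

    ◇-⊛lett-⊛zδ : ∀ v w →
      ◇ s (v ⊛ lett a) (w ⊛ zδ t) ≋ ◇ s v (w ⊛ zδ t) ⊛ q ⊕ c ◃ (◇ s (v ⊛ ŷ) w ⊛ zδ t)
    ◇-⊛lett-⊛zδ v w = begin
      ◇ s (v ⊛ lett a) (w ⊛ zδ t)
        ≈⟨ lin-⊛-lett (λ u → lin (◇w s u) (w ⊛ zδ t)) a v ⟩
      lin (λ u → lin (◇w s (u ▸ a)) (w ⊛ zδ t)) v
        ≈⟨ lin-cong (λ u → lin-◇w-▸-⊛zδ u w) v ⟩
      lin (λ u → lin (◇w s u) (w ⊛ zδ t) ⊛ q ⊕ c ◃ (lin (◇w s (u ▸ y₁)) w ⊛ zδ t)) v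
        ≈⟨ lin-combination (λ u → lin (◇w s u) (w ⊛ zδ t)) (λ u → lin (◇w s (u ▸ y₁)) w)
                           q c (zδ t) v ⟩
      ◇ s v (w ⊛ zδ t) ⊛ q ⊕ c ◃ (lin (λ u → lin (◇w s (u ▸ y₁)) w) v ⊛ zδ t)
        ≈⟨ ⊕-cong ≋-refl (◃-cong c (⊛-congˡ (zδ t) (lin-⊛-lett (λ u → lin (◇w s u) w) y₁ v))) ⟨
      ◇ s v (w ⊛ zδ t) ⊛ q ⊕ c ◃ (◇ s (v ⊛ ŷ) w ⊛ zδ t)
        ∎
      where open ≋-Reasoning

lemma5p3 : (n : ℕ) (s t : μ n) (v : Poly L₁) (w : Poly (Lr n)) →
    (◇ s (v ⊛ x̂) (w ⊛ zδ t)
       ≈ ◇ s v (w ⊛ zδ t) ⊛ zδ t ⊝ ◇ s (v ⊛ ŷ) w ⊛ zδ t)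
    × (◇ s (v ⊛ ŷ) (w ⊛ zδ t)
       ≈ ◇ s v (w ⊛ zδ t) ⊛ ◇ t ŷ 𝟙 ⊕ ◇ s (v ⊛ ŷ) w ⊛ zδ t)
lemma5p3 n s t v w = coeff-≡ identity-x , coeff-≡ identity-y
  where
  identity-x : ◇ s (v ⊛ x̂) (w ⊛ zδ t) ≋ ◇ s v (w ⊛ zδ t) ⊛ zδ t ⊝ ◇ s (v ⊛ ŷ) w ⊛ zδ t
  identity-x = ◇-⊛lett-⊛zδ s t x₁ (zδ t) (- 1ℚ) (λ u u′ → at-zδ-◇w-x₁ s u u′ t) v w

  identity-y : ◇ s (v ⊛ ŷ) (w ⊛ zδ t) ≋ ◇ s v (w ⊛ zδ t) ⊛ ◇ t ŷ 𝟙 ⊕ ◇ s (v ⊛ ŷ) w ⊛ zδ t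
  identity-y = ≋-trans (◇-⊛lett-⊛zδ s t y₁ (◇ t ŷ 𝟙) 1ℚ (λ u u′ → at-zδ-◇w-y₁ s u u′ t) v w)
                       (⊕-cong ≋-refl (◃-identityˡ (◇ s (v ⊛ ŷ) w ⊛ zδ t)))
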